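{- Let $\omega\in\Omega$ and let $B,B'$ be blocks of $\omega$ with $pl_\omega(B)=a$ and $pl_\omega(B')=a+1$. Then $B$ and $B'$ are combinable in $\omega$, i.e., they are either incomparable in $\omega$ or one of them covers the other.
   Context: A pre-order on $[n]$ is a reflexive transitive relation $\preceq$; blocks are classes of $i\equiv j\iff i\preceq j\preceq i$, partially ordered by $\preceq$. Blocks overlap if their intervals $[\min,\max]$ intersect; $B'$ covers $B$ if $B\prec B'$ with no block strictly between. $\Omega$ is the set of permutation pre-orders on $[n]$: (P1) overlapping blocks are comparable, (P2) every cover between blocks is between overlapping blocks. Placement: $\lambda(\omega)$ is the permutation obtained by writing each block of $\omega$ as a decreasing sequence and ordering them left to right so that $B_1\prec B_2$ puts $B_2$ right of $B_1$, and incomparable (non-overlapping) blocks are ordered by increasing value; $pl_\omega(B)$ is the position of the block $B$ in this left-to-right order, numbered from $1$. -}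

module Defs where

open import Data.Nat using (ℕ; suc)
open import Data.Fin using (Fin; _≤_; _<_)
open import Data.Fin.Properties using (_≤?_; _<?_; all?)
open import Data.Bool using (Bool; T)
open import Data.Bool.Properties using (T?)
open import Data.List using (List; length; filter)
open import Data.List using () renaming (allFin to allFinL)
open import Data.Product using (Σ; _×_; _,_)
open import Data.Product using () renaming (Σ-syntax to Σ-syn)
open import Data.Sum using (_⊎_)
open import Relation.Nullary using (¬_; Dec; yes; no)
open import Relation.Nullary.Decidable using (_×-dec_; _⊎-dec_; ¬?; _→-dec_)

record PreOrder (n : ℕ) : Set where
  field
    R     : Fin n → Fin n → Bool
    reflR : ∀ i → T (R i i)
    transR : ∀ i j k → T (R i j) → T (R j k) → T (R i k)

module _ {n : ℕ} (ω : PreOrder n) where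
  open PreOrder ω

  _⪯_ : Fin n → Fin n → Set
  i ⪯ j = T (R i j)

  _≈_ : Fin n → Fin n → Set
  i ≈ j = (i ⪯ j) × (j ⪯ i)

  -- Blocks are represented by any of their elements: the block of i is
  -- { k | k ≈ i }.  All notions below are invariant under change of
  -- representative.

  _≺_ : Fin n → Fin n → Set
  i ≺ j = (i ⪯ j) × ¬ (j ⪯ i)

  Comparable : Fin n → Fin n → Set
  Comparable i j = (i ⪯ j) ⊎ (j ⪯ i)

  Incomparable : Fin n → Fin n → Set
  Incomparable i j = ¬ (i ⪯ j) × ¬ (j ⪯ i)

  -- The intervals [min B, max B] and [min B', max B'] intersect,
  -- i.e. min B ≤ max B' and min B' ≤ max B.
  Overlap : Fin n → Fin n → Set
  Overlap i j =
    (Σ (Fin n) λ k → Σ (Fin n) λ l → (k ≈ i) × (l ≈ j) × (k ≤ l)) ×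
    (Σ (Fin n) λ k → Σ (Fin n) λ l → (k ≈ i) × (l ≈ j) × (l ≤ k))

  Covers : Fin n → Fin n → Set
  Covers j i = (i ≺ j) × (∀ c → ¬ ((i ≺ c) × (c ≺ j)))

  record IsPermPreorder : Set where
    field
      P1 : ∀ i j → Overlap i j → Comparable i j
      P2 : ∀ i j → Covers j i → Overlap i j

  Combinable : Fin n → Fin n → Set
  Combinable i j = Incomparable i j ⊎ Covers i j ⊎ Covers j i

  -- block i is placed (strictly) left of block j in λ(ω):
  -- either i ≺ j, or they are incomparable and every value of block i is
  -- smaller than every value of block j ("ordered by increasing value").
  Before : Fin n → Fin n → Set
  Before i j = (i ≺ j) ⊎ (Incomparable i j × (∀ k l → k ≈ i → l ≈ j → k < l))

  MinRep : Fin n → Set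
  MinRep k = ∀ k' → k' ≈ k → k ≤ k'

  private
    ⪯? : ∀ i j → Dec (i ⪯ j)
    ⪯? i j = T? (R i j)
    ≈? : ∀ i j → Dec (i ≈ j)
    ≈? i j = ⪯? i j ×-dec ⪯? j i
    ≺? : ∀ i j → Dec (i ≺ j)
    ≺? i j = ⪯? i j ×-dec ¬? (⪯? j i)
    Before? : ∀ i j → Dec (Before i j)
    Before? i j = ≺? i j ⊎-dec ((¬? (⪯? i j) ×-dec ¬? (⪯? j i)) ×-dec
      all? (λ k → all? (λ l → ≈? k i →-dec (≈? l j →-dec (k <? l)))))
    MinRep? : ∀ k → Dec (MinRep k)
    MinRep? k = all? (λ k' → ≈? k' k →-dec (k ≤? k'))

  -- pl_ω(block of i) = 1 + number of blocks placed before it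
  pl : Fin n → ℕ
  pl i = suc (length (filter (λ k → MinRep? k ×-dec Before? k i) (allFinL n)))

module Submission where

-- For a permutation pre-order (module Placement) places strictly increase
-- along ≺ (pl-≺), because "placed before" is transitive along ≺
-- (Before-≺-trans).  Its only non-trivial case is a block K incomparable to
-- both ends of X ≺ Y whose values lie above Y and below X; this is ruled out
-- (no-gap) by descending along a ≺-chain from X to Y down to a cover, whose
-- ends overlap by (P2) although K separates them.  (P1) is what makes an
-- incomparable block lie value-wise entirely on one side of another.
-- Hence comparable blocks B, B' in places a, a+1 satisfy B ≺ B', and a block
-- strictly between them would need a place strictly between a and a+1.

open import Defs
open import Data.Nat using (ℕ; suc)
open import Data.Fin using (Fin)
open import Relation.Binary.PropositionalEquality using (_≡_)

open import Level using (Level)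
open import Data.Nat using (s≤s) renaming (_≤_ to _≤ℕ_; _<_ to _<ℕ_)
import Data.Nat.Properties as ℕ
open import Data.Nat.Induction using () renaming (<-wellFounded to <ℕ-wellFounded)
open import Data.Fin using (toℕ; _≤_; _<_)
open import Data.Fin.Properties using (_≤?_; _<?_; any?; ≤-total)
open import Data.Bool.Properties using (T?)
open import Data.List using (length; filter; allFin)
open import Data.List.Membership.Propositional using (_∈_)
open import Data.List.Membership.Propositional.Properties using (∈-allFin; ∈-filter⁺; ∈-filter⁻)
open import Data.List.Relation.Binary.Pointwise using (Pointwise-≡⇒≡)
open import Data.List.Relation.Binary.Sublist.Propositional using (⊆-refl) renaming (_⊆_ to _⊑_)
open import Data.List.Relation.Binary.Sublist.Heterogeneous.Properties
  using (⊆-filter-Sublist; length-mono-≤; toPointwise)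
open import Data.Product using (Σ; _×_; _,_; proj₂; swap; map₁; map₂)
open import Data.Sum using (_⊎_; inj₁; inj₂)
open import Data.Empty using (⊥; ⊥-elim)
open import Induction.WellFounded using (Acc; acc)
open import Relation.Nullary using (¬_; Dec; yes; no)
open import Relation.Nullary.Decidable using (_×-dec_; ¬?)
open import Relation.Unary using (Pred; Decidable; _⊆_)
open import Relation.Binary.PropositionalEquality using (_≢_; refl; sym; trans; cong; subst)

module FilterCount {a p q : Level} {A : Set a} {P : Pred A p} {Q : Pred A q}
                   {P? : Decidable P} {Q? : Decidable Q} (P⇒Q : P ⊆ Q) where

  filter-sublist : ∀ xs → filter P? xs ⊑ filter Q? xs
  filter-sublist xs = ⊆-filter-Sublist P? Q? (λ { refl → P⇒Q }) (⊆-refl {x = xs})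

  length-filter-mono : ∀ xs → length (filter P? xs) ≤ℕ length (filter Q? xs)
  length-filter-mono xs = length-mono-≤ (filter-sublist xs)

  -- Equal lengths would make the P-filter a pointwise copy of the
  -- Q-filter, which contains w.
  length-filter-strict : ∀ {w xs} → w ∈ xs → Q w → ¬ P w →
                         length (filter P? xs) <ℕ length (filter Q? xs)
  length-filter-strict {w} {xs} w∈xs Qw ¬Pw =
    ℕ.≤∧≢⇒< (length-filter-mono xs) equal-length-impossible
    where
    equal-length-impossible : length (filter P? xs) ≢ length (filter Q? xs)
    equal-length-impossible eq = ¬Pw (proj₂ (∈-filter⁻ P? {xs = xs} w∈P-filter))
      where
      same-list : filter P? xs ≡ filter Q? xs
      same-list = Pointwise-≡⇒≡ (toPointwise eq (filter-sublist xs))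
      w∈P-filter : w ∈ filter P? xs
      w∈P-filter = subst (w ∈_) (sym same-list) (∈-filter⁺ Q? w∈xs Qw)

open FilterCount

module Blocks {n : ℕ} (ω : PreOrder n) where
  open PreOrder ω using (R; reflR; transR)

  _⪯ω_ _≈ω_ _≺ω_ : Fin n → Fin n → Set
  _⪯ω_ = _⪯_ ω
  _≈ω_ = _≈_ ω
  _≺ω_ = _≺_ ω

  ⪯? : ∀ i j → Dec (i ⪯ω j)
  ⪯? i j = T? (R i j)

  ≈? : ∀ i j → Dec (i ≈ω j)
  ≈? i j = ⪯? i j ×-dec ⪯? j i

  ≺? : ∀ i j → Dec (i ≺ω j)
  ≺? i j = ⪯? i j ×-dec ¬? (⪯? j i)

  ⪯-trans : ∀ {i j k} → i ⪯ω j → j ⪯ω k → i ⪯ω k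
  ⪯-trans {i} {j} {k} = transR i j k

  ≈-refl : ∀ {i} → i ≈ω i
  ≈-refl {i} = reflR i , reflR i

  ≈-sym : ∀ {i j} → i ≈ω j → j ≈ω i
  ≈-sym = swap

  ≈-trans : ∀ {i j k} → i ≈ω j → j ≈ω k → i ≈ω k
  ≈-trans (i⪯j , j⪯i) (j⪯k , k⪯j) = ⪯-trans i⪯j j⪯k , ⪯-trans k⪯j j⪯i

  incomparable-between : ∀ {k x y c} → Incomparable ω k x → Incomparable ω k y →
                         x ⪯ω c → c ⪯ω y → Incomparable ω k c
  incomparable-between (_ , x⋠k) (k⋠y , _) x⪯c c⪯y =
    (λ k⪯c → k⋠y (⪯-trans k⪯c c⪯y)) , (λ c⪯k → x⋠k (⪯-trans x⪯c c⪯k))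

  LeftOf : Fin n → Fin n → Set
  LeftOf i j = ∀ i' j' → i' ≈ω i → j' ≈ω j → i' < j'

  overlap-no-gap : ∀ {x y k} → Overlap ω x y → LeftOf k x → LeftOf y k → ⊥
  overlap-no-gap {k = k} ((x₀ , y₀ , x₀≈x , y₀≈y , x₀≤y₀) , _) k<x y<k =
    ℕ.<-irrefl refl (ℕ.<-trans (y<k y₀ k y₀≈y ≈-refl)
                               (ℕ.<-≤-trans (k<x k x₀ ≈-refl x₀≈x) x₀≤y₀))

  Before-respˡ : ∀ {i i' j} → i ≈ω i' → Before ω i j → Before ω i' j
  Before-respˡ (i⪯i' , i'⪯i) (inj₁ (i⪯j , j⋠i)) =
    inj₁ (⪯-trans i'⪯i i⪯j , λ j⪯i' → j⋠i (⪯-trans j⪯i' i'⪯i))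
  Before-respˡ i≈i'@(i⪯i' , i'⪯i) (inj₂ ((i⋠j , j⋠i) , i<j)) =
    inj₂ (((λ i'⪯j → i⋠j (⪯-trans i⪯i' i'⪯j)) , (λ j⪯i' → j⋠i (⪯-trans j⪯i' i'⪯i))) ,
          λ a b a≈i' b≈j → i<j a b (≈-trans a≈i' (≈-sym i≈i')) b≈j)

  Before-respʳ : ∀ {i j j'} → j ≈ω j' → Before ω i j → Before ω i j'
  Before-respʳ (j⪯j' , j'⪯j) (inj₁ (i⪯j , j⋠i)) =
    inj₁ (⪯-trans i⪯j j⪯j' , λ j'⪯i → j⋠i (⪯-trans j⪯j' j'⪯i))
  Before-respʳ j≈j'@(j⪯j' , j'⪯j) (inj₂ ((i⋠j , j⋠i) , i<j)) =
    inj₂ (((λ i⪯j' → i⋠j (⪯-trans i⪯j' j'⪯j)) , (λ j'⪯i → j⋠i (⪯-trans j⪯j' j'⪯i))) ,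
          λ a b a≈i b≈j' → i<j a b a≈i (≈-trans b≈j' (≈-sym j≈j')))

  Before-irrefl : ∀ {i} → ¬ Before ω i i
  Before-irrefl {i} (inj₁ (_ , i⋠i)) = i⋠i (reflR i)
  Before-irrefl {i} (inj₂ ((i⋠i , _) , _)) = i⋠i (reflR i)

  minimal-rep : ∀ i → Σ (Fin n) λ r → (r ≈ω i) × MinRep ω r
  minimal-rep i = descend i (<ℕ-wellFounded _) ≈-refl
    where
    descend : ∀ k → Acc _<ℕ_ (toℕ k) → k ≈ω i →
              Σ (Fin n) λ r → (r ≈ω i) × MinRep ω r
    descend k (acc smaller) k≈i with any? (λ k' → ≈? k' i ×-dec (k' <? k))
    ... | yes (k' , k'≈i , k'<k) = descend k' (smaller k'<k) k'≈i
    ... | no none = k , k≈i ,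
          λ k' k'≈k → ℕ.≮⇒≥ (λ k'<k → none (k' , ≈-trans k'≈k k≈i , k'<k))

  Earlier : Fin n → Fin n → Set
  Earlier i k = MinRep ω k × Before ω k i

  pl-mono : ∀ {i j} → (∀ {k} → Earlier i k → Earlier j k) → pl ω i ≤ℕ pl ω j
  pl-mono i⇒j = s≤s (length-filter-mono i⇒j (allFin n))

  pl-strict : ∀ {i j} → (∀ {k} → Earlier i k → Earlier j k) →
              ∀ {k} → Earlier j k → ¬ Earlier i k → pl ω i <ℕ pl ω j
  pl-strict i⇒j {k} j-k ¬i-k = s≤s (length-filter-strict i⇒j (∈-allFin k) j-k ¬i-k)

  pl-≈ : ∀ {i j} → i ≈ω j → pl ω i ≡ pl ω j
  pl-≈ i≈j = ℕ.≤-antisym (pl-mono (map₂ (Before-respʳ i≈j)))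
                         (pl-mono (map₂ (Before-respʳ (≈-sym i≈j))))

  interval-size : Fin n → Fin n → ℕ
  interval-size x y = length (filter (λ z → ⪯? x z ×-dec ⪯? z y) (allFin n))

  interval-shrinkˡ : ∀ {x c y} → x ≺ω c → c ⪯ω y → interval-size c y <ℕ interval-size x y
  interval-shrinkˡ {x} (x⪯c , c⋠x) c⪯y =
    length-filter-strict (map₁ (⪯-trans x⪯c)) (∈-allFin x) (reflR x , ⪯-trans x⪯c c⪯y)
                         (λ (c⪯x , _) → c⋠x c⪯x)

  interval-shrinkʳ : ∀ {x c y} → x ⪯ω c → c ≺ω y → interval-size x c <ℕ interval-size x y
  interval-shrinkʳ {y = y} x⪯c (c⪯y , y⋠c) =
    length-filter-strict (map₂ (λ z⪯c → ⪯-trans z⪯c c⪯y)) (∈-allFin y)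
                         (⪯-trans x⪯c c⪯y , reflR y) (λ (_ , y⪯c) → y⋠c y⪯c)

module Placement {n : ℕ} (ω : PreOrder n) (isPerm : IsPermPreorder ω) where
  open Blocks ω
  open IsPermPreorder isPerm

  -- (P1): incomparable blocks do not overlap, so one value inequality
  -- between them fixes their relative position.
  left-of-witness : ∀ {i j i₀ j₀} → Incomparable ω i j → i₀ ≈ω i → j₀ ≈ω j →
                    i₀ ≤ j₀ → LeftOf i j
  left-of-witness {i} {j} {i₀} {j₀} (i⋠j , j⋠i) i₀≈i j₀≈j i₀≤j₀ i' j' i'≈i j'≈j
    with j' ≤? i'
  ... | no j'≰i' = ℕ.≰⇒> j'≰i'
  ... | yes j'≤i' with P1 i j ((i₀ , j₀ , i₀≈i , j₀≈j , i₀≤j₀) , (i' , j' , i'≈i , j'≈j , j'≤i'))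
  ...   | inj₁ i⪯j = ⊥-elim (i⋠j i⪯j)
  ...   | inj₂ j⪯i = ⊥-elim (j⋠i j⪯i)

  incomparable-separated : ∀ {i j} → Incomparable ω i j → LeftOf i j ⊎ LeftOf j i
  incomparable-separated {i} {j} i∥j with ≤-total i j
  ... | inj₁ i≤j = inj₁ (left-of-witness i∥j ≈-refl ≈-refl i≤j)
  ... | inj₂ j≤i = inj₂ (left-of-witness (swap i∥j) ≈-refl ≈-refl j≤i)

  -- If y covers x the two overlap
  -- by (P2), contradicting y < k < x; otherwise recurse on x ≺ c or c ≺ y for
  -- a block c strictly between, according to the side of k on which c lies.
  no-gap : ∀ {x y k} → x ≺ω y → Incomparable ω k x → Incomparable ω k y →
           LeftOf k x → LeftOf y k → ⊥
  no-gap {x} {y} = go (<ℕ-wellFounded (interval-size x y))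
    where
    go : ∀ {x y k} → Acc _<ℕ_ (interval-size x y) → x ≺ω y →
         Incomparable ω k x → Incomparable ω k y → LeftOf k x → LeftOf y k → ⊥
    go {x} {y} (acc smaller) x≺y k∥x k∥y k<x y<k
      with any? (λ c → ≺? x c ×-dec ≺? c y)
    ... | no nothing-between =
      overlap-no-gap (P2 x y (x≺y , λ c between → nothing-between (c , between))) k<x y<k
    ... | yes (c , x≺c@(x⪯c , _) , c≺y@(c⪯y , _))
      with k∥c ← incomparable-between k∥x k∥y x⪯c c⪯y
      with incomparable-separated k∥c
    ... | inj₁ k<c = go (smaller (interval-shrinkˡ x≺c c⪯y)) c≺y k∥c k∥y k<c y<k
    ... | inj₂ c<k = go (smaller (interval-shrinkʳ x⪯c c≺y)) x≺c k∥x k∥c k<x c<k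

  Before-≺-trans : ∀ {k x y} → Before ω k x → x ≺ω y → Before ω k y
  Before-≺-trans (inj₁ (k⪯x , x⋠k)) (x⪯y , _) =
    inj₁ (⪯-trans k⪯x x⪯y , λ y⪯k → x⋠k (⪯-trans x⪯y y⪯k))
  Before-≺-trans {k} {y = y} (inj₂ (k∥x@(_ , x⋠k) , k<x)) x≺y@(x⪯y , _) = before-y (⪯? k y)
    where
    y⋠k : ¬ y ⪯ω k
    y⋠k y⪯k = x⋠k (⪯-trans x⪯y y⪯k)
    before-y : Dec (k ⪯ω y) → Before ω k y
    before-y (yes k⪯y) = inj₁ (k⪯y , y⋠k)
    before-y (no k⋠y) with incomparable-separated (k⋠y , y⋠k)
    ... | inj₁ k<y = inj₂ ((k⋠y , y⋠k) , k<y)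
    ... | inj₂ y<k = ⊥-elim (no-gap x≺y k∥x (k⋠y , y⋠k) k<x y<k)

  -- Places strictly increase along ≺: every block before i is before j,
  -- and the block of i itself is before j but not before i.
  pl-≺ : ∀ {i j} → i ≺ω j → pl ω i <ℕ pl ω j
  pl-≺ {i} i≺j with minimal-rep i
  ... | r , r≈i , r-min =
    pl-strict (map₂ (λ k-before-i → Before-≺-trans k-before-i i≺j))
              (r-min , Before-respˡ (≈-sym r≈i) (inj₁ i≺j))
              (λ (_ , r-before-i) → Before-irrefl (Before-respˡ r≈i r-before-i))

  -- Blocks in consecutive places are combinable: equal or reversed blocks
  -- contradict the order of their places, and a block strictly between
  -- them would need a place strictly between pl ω i and 1 + pl ω i.
  consecutive-combinable : ∀ i j → pl ω j ≡ suc (pl ω i) → Combinable ω i j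
  consecutive-combinable i j consecutive with ⪯? i j | ⪯? j i
  ... | no i⋠j | no j⋠i = inj₁ (i⋠j , j⋠i)
  ... | yes i⪯j | yes j⪯i =
    ⊥-elim (ℕ.1+n≢n (trans (sym consecutive) (sym (pl-≈ (i⪯j , j⪯i)))))
  ... | no i⋠j | yes j⪯i =
    ⊥-elim (ℕ.<⇒≱ (pl-≺ (j⪯i , i⋠j))
                  (ℕ.≤-trans (ℕ.n≤1+n _) (ℕ.≤-reflexive (sym consecutive))))
  ... | yes i⪯j | no j⋠i = inj₂ (inj₂ ((i⪯j , j⋠i) , nothing-between))
    where
    nothing-between : ∀ c → ¬ ((i ≺ω c) × (c ≺ω j))
    nothing-between c (i≺c , c≺j) =
      ℕ.<⇒≱ (pl-≺ i≺c) (ℕ.m<1+n⇒m≤n (subst (pl ω c <ℕ_) consecutive (pl-≺ c≺j)))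

lemma4p6 : (n : ℕ) (ω : PreOrder n) → IsPermPreorder ω →
           (i j : Fin n) (a : ℕ) → pl ω i ≡ a → pl ω j ≡ suc a →
           Combinable ω i j
lemma4p6 n ω isPerm i j a pl-i≡a pl-j≡1+a =
  Placement.consecutive-combinable ω isPerm i j (trans pl-j≡1+a (cong suc (sym pl-i≡a)))
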